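{- Let $p_1,\dots,p_n$ be distinct primes, $N=p_1^{\alpha_1}\cdots p_n^{\alpha_n}$ with $\alpha_1\ge\cdots\ge\alpha_n>0$, $N'=p_1\cdots p_n$, and let $\mathcal D$ be a maximal $N$-set. Put $\mathcal A=\{d : d\mid N',\ d\in\mathcal D\}$. Then for every $d\mid N'$, exactly one of $d$ and $\bar d=N'/d$ belongs to $\mathcal A$.
   Context: A set $\mathcal D$ of positive divisors of $N$ is an $N$-set if no two elements of $\mathcal D$ are coprime; it is maximal if no additional positive divisor of $N$ can be included while keeping this property. -}

module Defs where

open import Data.Nat using (ℕ; _<_; _^_)
open import Data.Nat.Divisibility using (_∣_)
open import Data.Nat.Coprimality using (Coprime)
open import Data.Nat.ListAction using (product)
open import Data.Fin using (Fin)
open import Data.List using (List; _∷_; tabulate)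
open import Data.List.Membership.Propositional using (_∈_; _∉_)
open import Data.Product using (_×_)
open import Data.Empty using (⊥)

∏ : ∀ {n} → (Fin n → ℕ) → ℕ
∏ f = product (tabulate f)

-- A finite set D of positive divisors of N, no two of which are coprime.
-- "No two" is read to include an element with itself, i.e. gcd(d,e) > 1
-- for all d, e ∈ D (so 1 ∉ D).
IsNSet : ℕ → List ℕ → Set
IsNSet N D =
  (∀ {d} → d ∈ D → 0 < d × d ∣ N) ×
  (∀ {d e} → d ∈ D → e ∈ D → Coprime d e → ⊥)

IsMaximalNSet : ℕ → List ℕ → Set
IsMaximalNSet N D =
  IsNSet N D ×
  (∀ x → 0 < x → x ∣ N → x ∉ D → IsNSet N (x ∷ D) → ⊥)

In𝒜 : ℕ → List ℕ → ℕ → Set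
In𝒜 N' D d = d ∣ N' × d ∈ D

module Submission where

-- * Not both d, d̄ ∈ D: since N' is squarefree (a square g·g dividing a
--   product of distinct primes forces g = 1), d and d̄ are coprime, and an
--   N-set never contains two coprime elements.
-- * At least one of d, d̄ ∈ D: by maximality, every positive divisor x ∉ D
--   of N has a "partner" in D, an element coprime to x (for x = 1 any
--   element works, and D is nonempty because N has a divisor > 1).  If
--   neither d nor d̄ lay in D, their partners e, f ∈ D would be coprime:
--   a common divisor c of e and f divides N and is coprime to d · d̄ = N',
--   hence to N (N has the same prime factors as N'), so c = 1.

open import Defs
open import Data.Nat using (ℕ; zero; suc; _*_; _^_; _<_; _≤_; z<s)
open import Data.Nat.Divisibility
  using (_∣_; divides; ∣-refl; ∣-trans; ∣1⇒≡1; 0∣⇒≡0; m∣m*n; n∣m*n;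
         *-pres-∣; *-cancelˡ-∣; quotient-∣; _∣?_)
open import Data.Nat.Coprimality
  using (Coprime; coprime?; coprime-divisor; 1-coprimeTo) renaming (sym to coprime-sym)
open import Data.Nat.Primality
  using (Prime; ¬prime[1]; prime⇒irreducible; prime⇒nonZero; euclidsLemma; productOfPrimes≥1)
open import Data.Fin using (Fin; zero; suc)
open import Data.Fin.Properties using (suc-injective)
open import Data.List using (List; _∷_)
open import Data.List.Membership.Propositional using (_∈_; _∉_; find; lose)
open import Data.List.Membership.DecPropositional Data.Nat._≟_ using (_∈?_)
open import Data.List.Relation.Unary.Any using (Any; here; there; any?)
open import Data.List.Relation.Unary.All.Properties using (tabulate⁺)
open import Data.Product using (Σ; _×_; _,_; proj₂)
open import Data.Sum using (_⊎_; inj₁; inj₂)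
open import Data.Empty using (⊥; ⊥-elim)
open import Relation.Nullary using (¬_; yes; no)
open import Relation.Binary.PropositionalEquality using (_≡_; refl; sym; subst)
open import Function.Definitions using (Injective)

coprime-∣ˡ : ∀ {a b c} → c ∣ a → Coprime a b → Coprime c b
coprime-∣ˡ c∣a cop (x∣c , x∣b) = cop (∣-trans x∣c c∣a , x∣b)

coprime-∣ʳ : ∀ {a b c} → c ∣ b → Coprime a b → Coprime a c
coprime-∣ʳ c∣b cop (x∣a , x∣c) = cop (x∣a , ∣-trans x∣c c∣b)

coprime-*ʳ : ∀ {a b c} → Coprime a b → Coprime a c → Coprime a (b * c)
coprime-*ʳ cab cac (x∣a , x∣bc) = cac (x∣a , coprime-divisor (coprime-∣ˡ x∣a cab) x∣bc)

coprime-^ʳ : ∀ {a b} k → Coprime a b → Coprime a (b ^ k)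
coprime-^ʳ zero    cab (_ , x∣1) = ∣1⇒≡1 x∣1
coprime-^ʳ (suc k) cab = coprime-*ʳ cab (coprime-^ʳ k cab)

coprime-divisor⇒≡1 : ∀ {g m} → g ∣ m → Coprime g m → g ≡ 1
coprime-divisor⇒≡1 g∣m cop = cop (∣-refl , g∣m)

prime-∤⇒coprime : ∀ {q n} → Prime q → ¬ q ∣ n → Coprime q n
prime-∤⇒coprime pq q∤n {c} (c∣q , c∣n) with prime⇒irreducible pq c∣q
... | inj₁ c≡1 = c≡1
... | inj₂ refl = ⊥-elim (q∤n c∣n)

prime-∣⇒¬self-coprime : ∀ {q m} → Prime q → q ∣ m → ¬ Coprime m m
prime-∣⇒¬self-coprime pq q∣m cop = ¬prime[1] (subst Prime (cop (q∣m , q∣m)) pq)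

∣-pos : ∀ {m n} → 0 < n → m ∣ n → 0 < m
∣-pos {zero} 0<n 0∣n with () ← subst (0 <_) (0∣⇒≡0 0∣n) 0<n
∣-pos {suc m} _ _ = z<s

∏-primes-pos : ∀ {n} (p : Fin n → ℕ) → (∀ i → Prime (p i)) → 0 < ∏ p
∏-primes-pos p pp = productOfPrimes≥1 (tabulate⁺ pp)

∏∣∏^ : ∀ {n} (p α : Fin n → ℕ) → (∀ i → 0 < α i) → ∏ p ∣ ∏ (λ i → p i ^ α i)
∏∣∏^ {zero}  p α αpos = ∣-refl
∏∣∏^ {suc n} p α αpos =
  *-pres-∣ (base∣power (α zero) (αpos zero))
           (∏∣∏^ (λ i → p (suc i)) (λ i → α (suc i)) (λ i → αpos (suc i)))
  where
  base∣power : ∀ {a} k → 0 < k → a ∣ a ^ k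
  base∣power (suc k) _ = m∣m*n _

-- N and N' have the same prime factors: whatever is coprime to ∏ pᵢ is
-- coprime to ∏ pᵢ^αᵢ (no primality needed).
coprime-∏^ : ∀ {n g} (p α : Fin n → ℕ) →
             Coprime g (∏ p) → Coprime g (∏ (λ i → p i ^ α i))
coprime-∏^ {zero}  p α cop = cop
coprime-∏^ {suc n} p α cop =
  coprime-*ʳ (coprime-^ʳ (α zero) (coprime-∣ʳ (m∣m*n _) cop))
             (coprime-∏^ (λ i → p (suc i)) (λ i → α (suc i)) (coprime-∣ʳ (n∣m*n (p zero)) cop))

prime∣prime : ∀ {q r} → Prime q → Prime r → q ∣ r → q ≡ r
prime∣prime pq pr q∣r with prime⇒irreducible pr q∣r
... | inj₁ q≡1 = ⊥-elim (¬prime[1] (subst Prime q≡1 pq))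
... | inj₂ q≡r = q≡r

prime-∣-∏-primes : ∀ {n q} (p : Fin n → ℕ) → (∀ i → Prime (p i)) →
                   Prime q → q ∣ ∏ p → Σ (Fin n) (λ i → q ≡ p i)
prime-∣-∏-primes {zero} p pp pq q∣1 = ⊥-elim (¬prime[1] (subst Prime (∣1⇒≡1 q∣1) pq))
prime-∣-∏-primes {suc n} p pp pq q∣∏
  with euclidsLemma (p zero) (∏ (λ i → p (suc i))) pq q∣∏
... | inj₁ q∣p₀ = zero , prime∣prime pq (pp zero) q∣p₀
... | inj₂ q∣rest with prime-∣-∏-primes (λ i → p (suc i)) (λ i → pp (suc i)) pq q∣rest
...   | i , q≡pᵢ = suc i , q≡pᵢ

-- Either p₀ ∣ g, and then
-- p₀ would divide the product of the other primes, or p₀ is coprime to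
-- g · g, which therefore divides the product of the other primes.
squarefree : ∀ {n g} (p : Fin n → ℕ) → (∀ i → Prime (p i)) → Injective _≡_ _≡_ p →
             g * g ∣ ∏ p → g ≡ 1
squarefree {zero} p pp inj gg∣1 = ∣1⇒≡1 (∣-trans (m∣m*n _) gg∣1)
squarefree {suc n} {g} p pp inj gg∣∏ with p zero ∣? g
... | yes p₀∣g with prime-∣-∏-primes (λ i → p (suc i)) (λ i → pp (suc i)) (pp zero) p₀∣rest
  where
  p₀∣rest : p zero ∣ ∏ (λ i → p (suc i))
  p₀∣rest = *-cancelˡ-∣ (p zero) {{prime⇒nonZero (pp zero)}}
              (∣-trans (*-pres-∣ p₀∣g p₀∣g) gg∣∏)
...   | i , p₀≡pᵢ with () ← inj p₀≡pᵢ
squarefree {suc n} {g} p pp inj gg∣∏ | no p₀∤g =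
  squarefree (λ i → p (suc i)) (λ i → pp (suc i)) (λ e → suc-injective (inj e))
    (coprime-divisor (coprime-sym (coprime-*ʳ p₀⊥g p₀⊥g)) gg∣∏)
  where
  p₀⊥g : Coprime (p zero) g
  p₀⊥g = prime-∤⇒coprime (pp zero) p₀∤g

complement-coprime : ∀ {n d d̄} (p : Fin n → ℕ) → (∀ i → Prime (p i)) →
                     Injective _≡_ _≡_ p → ∏ p ≡ d̄ * d → Coprime d d̄
complement-coprime p pp inj eq (c∣d , c∣d̄) =
  squarefree p pp inj (subst (_ ∣_) (sym eq) (*-pres-∣ c∣d̄ c∣d))

-- An element of D coprime to x: x can never join D alongside it.
Partner : List ℕ → ℕ → Set
Partner D x = Σ ℕ (λ e → e ∈ D × Coprime x e)

extend : ∀ {N D x} → IsNSet N D → 0 < x → x ∣ N → ¬ Coprime x x →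
         ¬ Any (Coprime x) D → IsNSet N (x ∷ D)
extend {N} {D} {x} (divisors , noCoprime) 0<x x∣N x⊥̸x noPartner = divisors′ , noCoprime′
  where
  inD : ∀ {e} → e ∈ D → Coprime x e → ⊥
  inD e∈D x⊥e = noPartner (lose e∈D (λ {c} → x⊥e {c}))
  divisors′ : ∀ {d} → d ∈ x ∷ D → 0 < d × d ∣ N
  divisors′ (here refl) = 0<x , x∣N
  divisors′ (there d∈D) = divisors d∈D
  noCoprime′ : ∀ {d e} → d ∈ x ∷ D → e ∈ x ∷ D → Coprime d e → ⊥
  noCoprime′ (here refl) (here refl) cop = x⊥̸x cop
  noCoprime′ (here refl) (there e∈D) cop = inD e∈D cop
  noCoprime′ (there d∈D) (here refl) cop = inD d∈D (coprime-sym cop)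
  noCoprime′ (there d∈D) (there e∈D) cop = noCoprime d∈D e∈D cop

partner-of-maximal : ∀ {N D x} → IsMaximalNSet N D → x ∉ D → 0 < x → x ∣ N →
                     ¬ Coprime x x → Partner D x
partner-of-maximal {N} {D} {x} (isNSet , maximal) x∉D 0<x x∣N x⊥̸x
  with any? (coprime? x) D
... | yes partner = find partner
... | no noPartner = ⊥-elim (maximal x 0<x x∣N x∉D (extend isNSet 0<x x∣N x⊥̸x noPartner))

maximal-nonempty : ∀ {N D y} → IsMaximalNSet N D → 0 < y → y ∣ N → ¬ Coprime y y →
                   Σ ℕ (_∈ D)
maximal-nonempty {D = D} {y} maxD 0<y y∣N y⊥̸y with y ∈? D
... | yes y∈D = y , y∈D
... | no y∉D with partner-of-maximal maxD y∉D 0<y y∣N y⊥̸y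
...   | e , e∈D , _ = e , e∈D

-- Under the same proviso, every positive divisor of N outside D (including
-- 1, which is coprime to everything) has a partner in D.
partner : ∀ {N D x y} → IsMaximalNSet N D → 0 < y → y ∣ N → ¬ Coprime y y →
          x ∉ D → 0 < x → x ∣ N → Partner D x
partner {x = x} maxD 0<y y∣N y⊥̸y x∉D 0<x x∣N with coprime? x x
... | no x⊥̸x = partner-of-maximal maxD x∉D 0<x x∣N x⊥̸x
... | yes x⊥x with maximal-nonempty maxD 0<y y∣N y⊥̸y
...   | e , e∈D rewrite coprime-divisor⇒≡1 ∣-refl x⊥x = e , e∈D , 1-coprimeTo e

-- If the only divisor of N coprime to both a and b is 1, then a and b
-- cannot both have partners in an N-set: the partners would be coprime.
partners-meet : ∀ {N D a b} → IsNSet N D →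
                (∀ {c} → c ∣ N → Coprime c a → Coprime c b → c ≡ 1) →
                Partner D a → Partner D b → ⊥
partners-meet (divisors , noCoprime) only1 (e , e∈D , a⊥e) (f , f∈D , b⊥f) =
  noCoprime e∈D f∈D λ (c∣e , c∣f) →
    only1 (∣-trans c∣e (proj₂ (divisors e∈D)))
          (coprime-∣ˡ c∣e (coprime-sym a⊥e))
          (coprime-∣ˡ c∣f (coprime-sym b⊥f))

lemma2 : (n : ℕ) → 0 < n →
         (p : Fin n → ℕ) → (∀ i → Prime (p i)) → Injective _≡_ _≡_ p →
         (α : Fin n → ℕ) → (∀ {i j} → i Data.Fin.≤ j → α j ≤ α i) → (∀ i → 0 < α i) →
         (D : List ℕ) → IsMaximalNSet (∏ (λ i → p i ^ α i)) D →
         (d : ℕ) → (d∣N' : d ∣ ∏ p) →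
         (In𝒜 (∏ p) D d ⊎ In𝒜 (∏ p) D (_∣_.quotient d∣N'))
           × ¬ (In𝒜 (∏ p) D d × In𝒜 (∏ p) D (_∣_.quotient d∣N'))
lemma2 (suc n) _ p pp inj α _ αpos D maxD@(isNSet , _) d d∣N'@(divides d̄ N'≡d̄d) =
  atLeastOne , notBoth
  where
  N'∣N : ∏ p ∣ ∏ (λ i → p i ^ α i)
  N'∣N = ∏∣∏^ p α αpos
  0<N' : 0 < ∏ p
  0<N' = ∏-primes-pos p pp
  N'⊥̸N' : ¬ Coprime (∏ p) (∏ p)
  N'⊥̸N' = prime-∣⇒¬self-coprime (pp zero) (m∣m*n _)
  d̄∣N' : d̄ ∣ ∏ p
  d̄∣N' = quotient-∣ d∣N'
  -- N' is a divisor > 1 of N, so every divisor of N' outside D has a partner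
  partner′ : ∀ {x} → x ∉ D → x ∣ ∏ p → Partner D x
  partner′ x∉D x∣N' = partner maxD 0<N' N'∣N N'⊥̸N' x∉D (∣-pos 0<N' x∣N') (∣-trans x∣N' N'∣N)
  -- a divisor of N coprime to d and d̄ is coprime to N' = d̄ · d, hence to N
  only1 : ∀ {c} → c ∣ ∏ (λ i → p i ^ α i) → Coprime c d → Coprime c d̄ → c ≡ 1
  only1 c∣N c⊥d c⊥d̄ =
    coprime-divisor⇒≡1 c∣N (coprime-∏^ p α (subst (Coprime _) (sym N'≡d̄d) (coprime-*ʳ c⊥d̄ c⊥d)))
  atLeastOne : In𝒜 (∏ p) D d ⊎ In𝒜 (∏ p) D d̄
  atLeastOne with d ∈? D | d̄ ∈? D
  ... | yes d∈D | _       = inj₁ (d∣N' , d∈D)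
  ... | no _    | yes d̄∈D = inj₂ (d̄∣N' , d̄∈D)
  ... | no d∉D  | no d̄∉D  = ⊥-elim (partners-meet isNSet only1 (partner′ d∉D d∣N') (partner′ d̄∉D d̄∣N'))
  notBoth : ¬ (In𝒜 (∏ p) D d × In𝒜 (∏ p) D d̄)
  notBoth ((_ , d∈D) , (_ , d̄∈D)) = proj₂ isNSet d∈D d̄∈D (complement-coprime p pp inj N'≡d̄d)
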